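{- Let $(a_n)_{n\ge 0}$ be a sequence of real numbers and $S_n(q)=\sum_{k=0}^{n}a_k\binom{n}{k}(1-q)^kq^{n-k}$. Then the sequence $(S_n(x+q-xq))_{n\ge0}$ is the Bernoulli transform (with parameter $q$) of the sequence $(S_n(x))_{n\ge 0}$, i.e. for every $n\ge 0$, $$S_n(x+q-xq)=S_n\bigl(1-(1-x)(1-q)\bigr)=\sum_{k=0}^{n}S_k(x)\binom{n}{k}(1-q)^kq^{n-k},$$ or equivalently $$S_n(1-xq)=\sum_{k=0}^{n}S_k(1-x)\binom{n}{k}(1-q)^{n-k}q^k .$$
   Context: The Bernoulli transform with parameter $q$ of a sequence $(b_n)_{n\ge0}$ is the sequence $\left(\sum_{k=0}^{n}b_k\binom{n}{k}(1-q)^kq^{n-k}\right)_{n\ge0}$. Here $x,q$ are indeterminates (or real numbers). -}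

module Defs where

open import Algebra.Bundles using (CommutativeRing)
open import Data.Nat using (ℕ; zero; suc; _∸_)
open import Data.Nat.Combinatorics using (_C_)

module _ {c ℓ} (R : CommutativeRing c ℓ) where
  open CommutativeRing R

  fromℕ : ℕ → Carrier
  fromℕ zero = 0#
  fromℕ (suc n) = 1# + fromℕ n

  pow : Carrier → ℕ → Carrier
  pow x zero = 1#
  pow x (suc n) = x * pow x n

  sumTo : ℕ → (ℕ → Carrier) → Carrier
  sumTo zero f = f 0
  sumTo (suc n) f = sumTo n f + f (suc n)

  bernoulli : Carrier → (ℕ → Carrier) → ℕ → Carrier
  bernoulli q b n = sumTo n (λ k → b k * fromℕ (n C k) * pow (1# - q) k * pow q (n ∸ k))

  S : (ℕ → Carrier) → ℕ → Carrier → Carrier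
  S a n q = bernoulli q a n

{-# OPTIONS --safe #-}
-- Write T(u,v) b for the sequence n ↦ Σₖ bₖ C(n,k) uᵏ vⁿ⁻ᵏ, so that the Bernoulli transform
-- with parameter q is T(1-q,q) and k ↦ Sₖ(x) is T(1-x,x) a. Pascal's rule gives
-- T(u,v) b (n+1) = v T(u,v) b n + u T(u,v) (b ∘ suc) n, i.e. T(u,v) b n = ((uE + v)ⁿ b)₀ for the
-- shift E, and substituting sE + t for E shows T(u,v) ∘ T(s,t) = T(us, ut + v). For Bernoulli
-- transforms the new parameters are (1-q)(1-x) = 1 - p and (1-q)x + q = p with p = x + q - xq.
-- The last identity is the first one at 1 - x and 1 - q, as (1-x) + (1-q) - (1-x)(1-q) = 1 - xq.
module Submission where

open import Algebra.Bundles using (CommutativeRing)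
open import Data.Nat using (ℕ; _∸_)
open import Data.Nat.Combinatorics using (_C_)
open import Data.Product using (_×_)
open import Defs

open import Data.Nat using (zero; suc; _≤_; z≤n)
import Data.Nat as ℕ
open import Data.Nat.Properties using (≤-refl; m≤n⇒m≤1+n; n<1+n; +-∸-assoc)
open import Data.Nat.Combinatorics using (nCk+nC[k+1]≡[n+1]C[k+1]; k>n⇒nCk≡0)
open import Data.Product using (_,_)
open import Function using (_∘_)
open import Relation.Binary.PropositionalEquality using (_≡_; cong)
import Algebra.Properties.CommutativeSemigroup as CommutativeSemigroupProperties
import Algebra.Properties.Group as GroupProperties
import Algebra.Properties.Quasigroup as QuasigroupProperties
import Algebra.Solver.Ring.NaturalCoefficients.Default as NaturalCoefficientsSolver
import Relation.Binary.Reasoning.Setoid as SetoidReasoning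

module _ {c ℓ} (R : CommutativeRing c ℓ) where
  open CommutativeRing R
  open SetoidReasoning setoid
  open NaturalCoefficientsSolver commutativeSemiring
  open CommutativeSemigroupProperties +-commutativeSemigroup using (interchange)
  open GroupProperties +-group using (quasigroup; //-rightDividesˡ)
  open QuasigroupProperties quasigroup renaming (x≈z//y to x+y≈z⇒x≈z-y)

  sumTo-cong : ∀ n {f g : ℕ → Carrier} →
    (∀ {k} → k ≤ n → f k ≈ g k) → sumTo R n f ≈ sumTo R n g
  sumTo-cong zero    f≈g = f≈g z≤n
  sumTo-cong (suc n) f≈g = +-cong (sumTo-cong n (f≈g ∘ m≤n⇒m≤1+n)) (f≈g ≤-refl)

  sumTo-distrib-+ : ∀ n (f g : ℕ → Carrier) →
    sumTo R n (λ k → f k + g k) ≈ sumTo R n f + sumTo R n g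
  sumTo-distrib-+ zero    f g = refl
  sumTo-distrib-+ (suc n) f g =
    trans (+-congʳ (sumTo-distrib-+ n f g)) (interchange _ _ _ _)

  *-distribˡ-sumTo : ∀ n a (f : ℕ → Carrier) → a * sumTo R n f ≈ sumTo R n (λ k → a * f k)
  *-distribˡ-sumTo zero    a f = refl
  *-distribˡ-sumTo (suc n) a f = trans (distribˡ a _ _) (+-congʳ (*-distribˡ-sumTo n a f))

  sumTo-head : ∀ n (f : ℕ → Carrier) → sumTo R (suc n) f ≈ f 0 + sumTo R n (f ∘ suc)
  sumTo-head zero    f = refl
  sumTo-head (suc n) f = trans (+-congʳ (sumTo-head n f)) (+-assoc _ _ _)

  fromℕ-+ : ∀ m n → fromℕ R (m ℕ.+ n) ≈ fromℕ R m + fromℕ R n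
  fromℕ-+ zero    n = sym (+-identityˡ _)
  fromℕ-+ (suc m) n = trans (+-congˡ (fromℕ-+ m n)) (sym (+-assoc _ _ _))

  pow-congˡ : ∀ {x y} n → x ≈ y → pow R x n ≈ pow R y n
  pow-congˡ zero    x≈y = refl
  pow-congˡ (suc n) x≈y = *-cong x≈y (pow-congˡ n x≈y)

  binomialTransform : Carrier → Carrier → (ℕ → Carrier) → ℕ → Carrier
  binomialTransform u v b n =
    sumTo R n (λ k → b k * fromℕ R (n C k) * pow R u k * pow R v (n ∸ k))

  binomialTransform-cong : ∀ {u u′ v v′} {b b′ : ℕ → Carrier} n →
    u ≈ u′ → v ≈ v′ → (∀ k → b k ≈ b′ k) →
    binomialTransform u v b n ≈ binomialTransform u′ v′ b′ n
  binomialTransform-cong n u≈u′ v≈v′ b≈b′ = sumTo-cong n λ {k} _ →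
    *-cong (*-cong (*-congʳ (b≈b′ k)) (pow-congˡ k u≈u′)) (pow-congˡ (n ∸ k) v≈v′)

  binomialTransform-linear : ∀ u v α β (b d : ℕ → Carrier) n →
    binomialTransform u v (λ k → α * b k + β * d k) n ≈
    α * binomialTransform u v b n + β * binomialTransform u v d n
  binomialTransform-linear u v α β b d n = begin
    binomialTransform u v (λ k → α * b k + β * d k) n
      ≈⟨ sumTo-cong n (λ {k} _ → distribute α β (b k) (d k) _ _ _) ⟩
    sumTo R n (λ k → α * term b k + β * term d k)
      ≈⟨ sumTo-distrib-+ n _ _ ⟩
    sumTo R n (λ k → α * term b k) + sumTo R n (λ k → β * term d k)
      ≈⟨ +-cong (*-distribˡ-sumTo n α (term b)) (*-distribˡ-sumTo n β (term d)) ⟨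
    α * binomialTransform u v b n + β * binomialTransform u v d n ∎
    where
    term : (ℕ → Carrier) → ℕ → Carrier
    term b k = b k * fromℕ R (n C k) * pow R u k * pow R v (n ∸ k)
    distribute : ∀ α β b d C U V →
      (α * b + β * d) * C * U * V ≈ α * (b * C * U * V) + β * (d * C * U * V)
    distribute = solve 7 (λ α β b d C U V → (α :* b :+ β :* d) :* C :* U :* V
                                          := α :* (b :* C :* U :* V) :+ β :* (d :* C :* U :* V)) refl

  binomialTransform-zero : ∀ u v (b : ℕ → Carrier) → binomialTransform u v b 0 ≈ b 0
  binomialTransform-zero u v b =
    trans (*-identityʳ _) (trans (*-identityʳ _) (trans (*-congˡ (+-identityʳ 1#)) (*-identityʳ _)))

  binomialTransform-suc : ∀ u v (b : ℕ → Carrier) n →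
    binomialTransform u v b (suc n) ≈
    v * binomialTransform u v b n + u * binomialTransform u v (b ∘ suc) n
  binomialTransform-suc u v b n = begin
    sumTo R (suc n) next
      ≈⟨ sumTo-head n next ⟩
    next 0 + sumTo R n (next ∘ suc)
      ≈⟨ +-congˡ (sumTo-cong n (λ {j} _ → pascal j)) ⟩
    next 0 + sumTo R n (λ j → u * shifted j + raised (suc j))
      ≈⟨ +-congˡ (sumTo-distrib-+ n _ _) ⟩
    next 0 + (sumTo R n (λ j → u * shifted j) + sumTo R n (raised ∘ suc))
      ≈⟨ +-congˡ (+-congʳ (*-distribˡ-sumTo n u shifted)) ⟨
    next 0 + (u * binomialTransform u v (b ∘ suc) n + sumTo R n (raised ∘ suc))
      ≈⟨ rearrange _ _ _ ⟩
    (raised 0 + sumTo R n (raised ∘ suc)) + u * binomialTransform u v (b ∘ suc) n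
      ≈⟨ +-congʳ (trans (sym (sumTo-head n raised)) raised-sum) ⟩
    v * binomialTransform u v b n + u * binomialTransform u v (b ∘ suc) n ∎
    where
    next shifted raised : ℕ → Carrier
    next    k = b k * fromℕ R (suc n C k) * pow R u k * pow R v (suc n ∸ k)
    shifted j = b (suc j) * fromℕ R (n C j) * pow R u j * pow R v (n ∸ j)
    raised  k = b k * fromℕ R (n C k) * pow R u k * pow R v (suc n ∸ k)

    rearrange : ∀ a b c → a + (b + c) ≈ (a + c) + b
    rearrange = solve 3 (λ a b c → a :+ (b :+ c) := (a :+ c) :+ b) refl

    pascal : ∀ j → next (suc j) ≈ u * shifted j + raised (suc j)
    pascal j = begin
      b (suc j) * fromℕ R (suc n C suc j) * (u * pow R u j) * pow R v (n ∸ j)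
        ≈⟨ *-congʳ (*-congʳ (*-congˡ (reflexive (cong (fromℕ R) pascal-ℕ)))) ⟨
      b (suc j) * fromℕ R (n C j ℕ.+ n C suc j) * (u * pow R u j) * pow R v (n ∸ j)
        ≈⟨ *-congʳ (*-congʳ (*-congˡ (fromℕ-+ (n C j) (n C suc j)))) ⟩
      b (suc j) * (fromℕ R (n C j) + fromℕ R (n C suc j)) * (u * pow R u j) * pow R v (n ∸ j)
        ≈⟨ distribute _ _ _ _ _ _ ⟩
      u * shifted j + raised (suc j) ∎
      where
      pascal-ℕ : n C j ℕ.+ n C suc j ≡ suc n C suc j
      pascal-ℕ = nCk+nC[k+1]≡[n+1]C[k+1] n j
      distribute : ∀ B X Y U P V →
        B * (X + Y) * (U * P) * V ≈ U * (B * X * P * V) + B * Y * (U * P) * V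
      distribute = solve 6 (λ B X Y U P V → B :* (X :+ Y) :* (U :* P) :* V
                                          := U :* (B :* X :* P :* V) :+ B :* Y :* (U :* P) :* V) refl

    raised-sum : sumTo R (suc n) raised ≈ v * binomialTransform u v b n
    raised-sum = begin
      sumTo R n raised + raised (suc n)
        ≈⟨ +-cong (sumTo-cong n raise) last-vanishes ⟩
      sumTo R n (λ k → v * (b k * fromℕ R (n C k) * pow R u k * pow R v (n ∸ k))) + 0#
        ≈⟨ +-identityʳ _ ⟩
      sumTo R n (λ k → v * (b k * fromℕ R (n C k) * pow R u k * pow R v (n ∸ k)))
        ≈⟨ *-distribˡ-sumTo n v _ ⟨
      v * binomialTransform u v b n ∎
      where
      raise : ∀ {k} → k ≤ n → raised k ≈ v * (b k * fromℕ R (n C k) * pow R u k * pow R v (n ∸ k))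
      raise k≤n =
        trans (*-congˡ (reflexive (cong (pow R v) (+-∸-assoc 1 k≤n)))) (commute _ _ _ _ _)
        where
        commute : ∀ B X U V P → B * X * U * (V * P) ≈ V * (B * X * U * P)
        commute = solve 5 (λ B X U V P → B :* X :* U :* (V :* P) := V :* (B :* X :* U :* P)) refl
      last-vanishes : raised (suc n) ≈ 0#
      last-vanishes = begin
        b (suc n) * fromℕ R (n C suc n) * pow R u (suc n) * pow R v (n ∸ n)
          ≈⟨ *-congʳ (*-congʳ (*-congˡ (reflexive (cong (fromℕ R) (k>n⇒nCk≡0 (n<1+n n)))))) ⟩
        b (suc n) * 0# * pow R u (suc n) * pow R v (n ∸ n)
          ≈⟨ trans (*-congʳ (*-congʳ (zeroʳ _))) (trans (*-congʳ (zeroˡ _)) (zeroˡ _)) ⟩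
        0# ∎

  binomialTransform-∘ : ∀ u v s t n (b : ℕ → Carrier) →
    binomialTransform u v (binomialTransform s t b) n ≈ binomialTransform (u * s) (u * t + v) b n
  binomialTransform-∘ u v s t zero b =
    trans (binomialTransform-zero u v (binomialTransform s t b))
      (trans (binomialTransform-zero s t b) (sym (binomialTransform-zero (u * s) (u * t + v) b)))
  binomialTransform-∘ u v s t (suc n) b = begin
    T[u,v] (T[s,t] b) (suc n)
      ≈⟨ binomialTransform-suc u v _ n ⟩
    v * T[u,v] (T[s,t] b) n + u * T[u,v] (T[s,t] b ∘ suc) n
      ≈⟨ +-congˡ (*-congˡ (binomialTransform-cong n refl refl (binomialTransform-suc s t b))) ⟩
    v * T[u,v] (T[s,t] b) n + u * T[u,v] (λ k → t * T[s,t] b k + s * T[s,t] (b ∘ suc) k) n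
      ≈⟨ +-congˡ (*-congˡ (binomialTransform-linear u v t s _ _ n)) ⟩
    v * T[u,v] (T[s,t] b) n + u * (t * T[u,v] (T[s,t] b) n + s * T[u,v] (T[s,t] (b ∘ suc)) n)
      ≈⟨ +-cong (*-congˡ IH) (*-congˡ (+-cong (*-congˡ IH) (*-congˡ IH-shifted))) ⟩
    v * T[us,ut+v] b n + u * (t * T[us,ut+v] b n + s * T[us,ut+v] (b ∘ suc) n)
      ≈⟨ regroup u v s t _ _ ⟩
    (u * t + v) * T[us,ut+v] b n + (u * s) * T[us,ut+v] (b ∘ suc) n
      ≈⟨ binomialTransform-suc (u * s) (u * t + v) b n ⟨
    T[us,ut+v] b (suc n) ∎
    where
    T[u,v] T[s,t] T[us,ut+v] : (ℕ → Carrier) → ℕ → Carrier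
    T[u,v]     = binomialTransform u v
    T[s,t]     = binomialTransform s t
    T[us,ut+v] = binomialTransform (u * s) (u * t + v)

    IH : T[u,v] (T[s,t] b) n ≈ T[us,ut+v] b n
    IH = binomialTransform-∘ u v s t n b
    IH-shifted : T[u,v] (T[s,t] (b ∘ suc)) n ≈ T[us,ut+v] (b ∘ suc) n
    IH-shifted = binomialTransform-∘ u v s t n (b ∘ suc)

    regroup : ∀ u v s t X Y → v * X + u * (t * X + s * Y) ≈ (u * t + v) * X + (u * s) * Y
    regroup = solve 6 (λ u v s t X Y → v :* X :+ u :* (t :* X :+ s :* Y)
                                    := (u :* t :+ v) :* X :+ (u :* s) :* Y) refl

  [1-x]+x≈1 : ∀ x → (1# - x) + x ≈ 1#
  [1-x]+x≈1 x = //-rightDividesˡ x 1#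

  1-[1-x]≈x : ∀ x → 1# - (1# - x) ≈ x
  1-[1-x]≈x x = sym (x+y≈z⇒x≈z-y x _ 1# (trans (+-comm x _) ([1-x]+x≈1 x)))

  [1-q]x+q≈x+q-xq : ∀ x q → (1# - q) * x + q ≈ x + q - x * q
  [1-q]x+q≈x+q-xq x q = x+y≈z⇒x≈z-y _ _ _ (begin
    (1# - q) * x + q + x * q  ≈⟨ collect (1# - q) x q ⟩
    ((1# - q) + q) * x + q    ≈⟨ +-congʳ (trans (*-congʳ ([1-x]+x≈1 q)) (*-identityˡ x)) ⟩
    x + q                     ∎)
    where
    collect : ∀ a x q → a * x + q + x * q ≈ (a + q) * x + q
    collect = solve 3 (λ a x q → a :* x :+ q :+ x :* q := (a :+ q) :* x :+ q) refl

  [1-q][1-x]+[x+q-xq]≈1 : ∀ x q → (1# - q) * (1# - x) + (x + q - x * q) ≈ 1#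
  [1-q][1-x]+[x+q-xq]≈1 x q = begin
    (1# - q) * (1# - x) + (x + q - x * q)    ≈⟨ +-congˡ ([1-q]x+q≈x+q-xq x q) ⟨
    (1# - q) * (1# - x) + ((1# - q) * x + q) ≈⟨ factor (1# - q) (1# - x) x q ⟩
    (1# - q) * ((1# - x) + x) + q            ≈⟨ +-congʳ (trans (*-congˡ ([1-x]+x≈1 x)) (*-identityʳ _)) ⟩
    (1# - q) + q                             ≈⟨ [1-x]+x≈1 q ⟩
    1#                                       ∎
    where
    factor : ∀ a y x q → a * y + (a * x + q) ≈ a * (y + x) + q
    factor = solve 4 (λ a y x q → a :* y :+ (a :* x :+ q) := a :* (y :+ x) :+ q) refl

  [1-q][1-x]≈1-[x+q-xq] : ∀ x q → (1# - q) * (1# - x) ≈ 1# - (x + q - x * q)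
  [1-q][1-x]≈1-[x+q-xq] x q = x+y≈z⇒x≈z-y _ _ _ ([1-q][1-x]+[x+q-xq]≈1 x q)

  x+q-xq≈1-[1-x][1-q] : ∀ x q → x + q - x * q ≈ 1# - (1# - x) * (1# - q)
  x+q-xq≈1-[1-x][1-q] x q = x+y≈z⇒x≈z-y _ _ _
    (trans (+-comm _ _) (trans (+-congʳ (*-comm _ _)) ([1-q][1-x]+[x+q-xq]≈1 x q)))

  1-xq≈[1-x]+[1-q]-[1-x][1-q] : ∀ x q → 1# - x * q ≈ (1# - x) + (1# - q) - (1# - x) * (1# - q)
  1-xq≈[1-x]+[1-q]-[1-x][1-q] x q = begin
    1# - x * q
      ≈⟨ +-congˡ (-‿cong (*-cong (1-[1-x]≈x x) (1-[1-x]≈x q))) ⟨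
    1# - (1# - (1# - x)) * (1# - (1# - q))
      ≈⟨ x+q-xq≈1-[1-x][1-q] (1# - x) (1# - q) ⟨
    (1# - x) + (1# - q) - (1# - x) * (1# - q) ∎

  bernoulli-cong : ∀ {q q′} (b : ℕ → Carrier) n →
    q ≈ q′ → bernoulli R q b n ≈ bernoulli R q′ b n
  bernoulli-cong b n q≈q′ = binomialTransform-cong n (+-congˡ (-‿cong q≈q′)) q≈q′ (λ _ → refl)

  bernoulli-∘ : ∀ x q (b : ℕ → Carrier) n →
    bernoulli R q (λ k → bernoulli R x b k) n ≈ bernoulli R (x + q - x * q) b n
  bernoulli-∘ x q b n = trans (binomialTransform-∘ (1# - q) q (1# - x) x n b)
    (binomialTransform-cong n ([1-q][1-x]≈1-[x+q-xq] x q) ([1-q]x+q≈x+q-xq x q) (λ _ → refl))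

  bernoulli-complement : ∀ q (b : ℕ → Carrier) n →
    bernoulli R (1# - q) b n ≈
    sumTo R n (λ k → b k * fromℕ R (n C k) * pow R (1# - q) (n ∸ k) * pow R q k)
  bernoulli-complement q b n = sumTo-cong n λ {k} _ →
    trans (swap _ _ _) (*-congˡ (pow-congˡ k (1-[1-x]≈x q)))
    where
    swap : ∀ a X Y → a * X * Y ≈ a * Y * X
    swap = solve 3 (λ a X Y → a :* X :* Y := a :* Y :* X) refl

mainTheorem6 : ∀ {c ℓ} (R : CommutativeRing c ℓ) → let open CommutativeRing R in
    (a : ℕ → Carrier) (x q : Carrier) (n : ℕ) →
      (S R a n (x + q - x * q) ≈ bernoulli R q (λ k → S R a k x) n)
      × (S R a n (x + q - x * q) ≈ S R a n (1# - (1# - x) * (1# - q)))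
      × (S R a n (1# - x * q) ≈ sumTo R n (λ k → S R a k (1# - x) * fromℕ R (n C k) * pow R (1# - q) (n ∸ k) * pow R q k))
mainTheorem6 R a x q n =
    sym (bernoulli-∘ R x q a n)
  , bernoulli-cong R a n (x+q-xq≈1-[1-x][1-q] R x q)
  , (begin
      S R a n (1# - x * q)
        ≈⟨ bernoulli-cong R a n (1-xq≈[1-x]+[1-q]-[1-x][1-q] R x q) ⟩
      S R a n ((1# - x) + (1# - q) - (1# - x) * (1# - q))
        ≈⟨ bernoulli-∘ R (1# - x) (1# - q) a n ⟨
      bernoulli R (1# - q) (λ k → S R a k (1# - x)) n
        ≈⟨ bernoulli-complement R q _ n ⟩
      sumTo R n (λ k → S R a k (1# - x) * fromℕ R (n C k) * pow R (1# - q) (n ∸ k) * pow R q k) ∎)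
  where
  open CommutativeRing R
  open SetoidReasoning setoid
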